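{- Let $k<d$ be positive integers and $c\in[d]$. Any path in $G(k,d)$ from a vertex $w\in W_d(k)$ to a vertex $w'\in W_d(k)$ with $b_c(w)\neq b_c(w')$ must either traverse an edge colored $c$ or visit $\alpha$.
   Context: $W_d$ is the set of words of length $d$ over $\{0,1\}$ with first letter $1$. Each $w\in W_d$ is uniquely a concatenation $B_1(w)B_2(w)\cdots B_q(w)$ of nonempty maximal constant subwords (blocks), $B_i(w)$ consisting of 1's for $i$ odd and 0's for $i$ even; $b_j(w)$ is the index of the block containing the letter $w_j$. $W_d(k)$ is the set of words in $W_d$ with exactly $k+1$ blocks. $G'(k,d)$ is the edge-labeled multigraph on vertex set $W_d(k)$ in which two words that differ only in position $j$ are joined by an edge labeled $j$. $G(k,d)$ is obtained from $G'(k,d)$ by adding a new vertex $\alpha$ and, for each $w\in W_d(k)$ and each $j$ such that $w_j$ lies in a block of size one of $w$, an edge labeled $j$ between $w$ and $\alpha$. -}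

module Defs where

open import Data.Nat using (ℕ; zero; suc; _+_)
open import Data.Bool using (Bool; true; false; if_then_else_)
open import Data.Bool.Properties using () renaming (_≟_ to _≟ᴮ_)
open import Data.Fin using (Fin; zero; suc)
open import Data.Vec using (Vec; []; _∷_; lookup)
open import Data.Maybe using (Maybe; just; nothing)
open import Data.List using (List; []; _∷_)
open import Data.List.Relation.Unary.Unique.Propositional using (Unique)
open import Relation.Binary.PropositionalEquality using (_≡_; _≢_)
open import Relation.Nullary using (does)
open import Data.Empty using (⊥)

-- Words of length d over {0,1}: Vec Bool d, with true = 1, false = 0.
-- Positions 1..d of the paper are Fin d (position j+1 of the paper is index j).

boundary : Bool → Bool → ℕ
boundary x y = if does (x ≟ᴮ y) then 0 else 1

blockIdx : ∀ {n} → Vec Bool n → Fin n → ℕ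
blockIdx (x ∷ xs) zero = 1
blockIdx (x ∷ y ∷ xs) (suc j) = boundary x y + blockIdx (y ∷ xs) j

numBlocks : ∀ {n} → Vec Bool n → ℕ
numBlocks [] = 0
numBlocks (x ∷ []) = 1
numBlocks (x ∷ y ∷ xs) = boundary x y + numBlocks (y ∷ xs)

FirstIsOne : ∀ {n} → Vec Bool n → Set
FirstIsOne [] = ⊥
FirstIsOne (x ∷ _) = x ≡ true

InW : ∀ {d} → ℕ → Vec Bool d → Set
InW k w = FirstIsOne w × (numBlocks w ≡ suc k)
  where open import Data.Product using (_×_)

SingletonBlock : ∀ {d} → Vec Bool d → Fin d → Set
SingletonBlock w j = ∀ i → i ≢ j → blockIdx w i ≢ blockIdx w j

-- Vertices of G(k,d): nothing = α, just w = a word (edges only touch words of W_d(k))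
Vertex : ℕ → Set
Vertex d = Maybe (Vec Bool d)

-- Labeled edges of G(k,d) (undirected: both orientations of an α-edge are included;
-- word–word edges are symmetric by definition)
data Edge {d : ℕ} (k : ℕ) : Vertex d → Vertex d → Fin d → Set where
  word-word : ∀ {u v j} → InW k u → InW k v →
              lookup u j ≢ lookup v j →
              (∀ i → i ≢ j → lookup u i ≡ lookup v i) →
              Edge k (just u) (just v) j
  word-α    : ∀ {w j} → InW k w → SingletonBlock w j → Edge k (just w) nothing j
  α-word    : ∀ {w j} → InW k w → SingletonBlock w j → Edge k nothing (just w) j

data Walk {d : ℕ} (k : ℕ) : Vertex d → Vertex d → Set where
  [] : ∀ {u} → Walk k u u
  _∷_ : ∀ {u v x j} → Edge k u v j → Walk k v x → Walk k u x

labels : ∀ {d k} {u v : Vertex d} → Walk k u v → List (Fin d)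
labels [] = []
labels (_∷_ {j = j} e p) = j ∷ labels p

vertices : ∀ {d k} {u v : Vertex d} → Walk k u v → List (Vertex d)
vertices {u = u} [] = u ∷ []
vertices {u = u} (e ∷ p) = u ∷ vertices p

IsPath : ∀ {d k} {u v : Vertex d} → Walk k u v → Set
IsPath p = Unique (vertices p)

-- A word–word edge labelled j changes only the letter at j and keeps the number of
-- blocks; blocks before j are untouched, and since the count of blocks after j is
-- untouched too, so is the block index of every letter after j.  Hence along a walk
-- avoiding α, b_c can only change across an edge labelled c.
module Submission where

open import Defs
open import Data.Nat using (ℕ; _<_; _≤_; _+_)
open import Data.Nat.Properties using (+-assoc; +-cancelʳ-≡; +-cancelˡ-≡)
open import Data.Fin using (Fin; zero; suc)
open import Data.Fin.Properties using (suc-injective; _≟_)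
open import Data.Vec using (Vec; []; _∷_; lookup)
open import Data.Vec.Properties using (tabulate∘lookup; tabulate-cong)
open import Data.Bool using (Bool)
open import Data.Maybe using (just; nothing)
open import Data.Sum using (_⊎_; inj₁; inj₂)
import Data.Sum as Sum
open import Data.Product using (_,_)
open import Data.List.Membership.Propositional using (_∈_)
open import Data.List.Relation.Unary.Any using (here; there)
open import Data.Empty using (⊥-elim)
open import Function using (_∘_)
open import Relation.Nullary using (yes; no)
open import Relation.Binary.PropositionalEquality
  using (_≡_; _≢_; _≗_; refl; sym; trans; cong; module ≡-Reasoning)

replace-last-summand : ∀ a b a′ b′ m n →
  a + (b + m) ≡ a′ + (b′ + m) → a + (b + n) ≡ a′ + (b′ + n)
replace-last-summand a b a′ b′ m n eq = begin
  a + (b + n)     ≡⟨ sym (+-assoc a b n) ⟩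
  a + b + n       ≡⟨ cong (_+ n) a+b≡a′+b′ ⟩
  a′ + b′ + n     ≡⟨ +-assoc a′ b′ n ⟩
  a′ + (b′ + n)   ∎
  where
  open ≡-Reasoning
  a+b≡a′+b′ : a + b ≡ a′ + b′
  a+b≡a′+b′ = +-cancelʳ-≡ m _ _ (trans (+-assoc a b m) (trans eq (sym (+-assoc a′ b′ m))))

lookup-injective : ∀ {A : Set} {n} (u v : Vec A n) → lookup u ≗ lookup v → u ≡ v
lookup-injective u v u≗v =
  trans (sym (tabulate∘lookup u)) (trans (tabulate-cong u≗v) (tabulate∘lookup v))

DifferOnlyAt : ∀ {A : Set} {n} → Vec A n → Vec A n → Fin n → Set
DifferOnlyAt u v j = ∀ i → i ≢ j → lookup u i ≡ lookup v i

module _ {A : Set} {n} {x y : A} {u v : Vec A n} {j : Fin n} where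

  DifferOnlyAt-head : DifferOnlyAt (x ∷ u) (y ∷ v) (suc j) → x ≡ y
  DifferOnlyAt-head u≈v = u≈v zero (λ ())

  DifferOnlyAt-tail : DifferOnlyAt (x ∷ u) (y ∷ v) (suc j) → DifferOnlyAt u v j
  DifferOnlyAt-tail u≈v i i≢j = u≈v (suc i) (i≢j ∘ suc-injective)

blockIdx-∷-stable : ∀ {n} x (u v : Vec Bool n) {j c : Fin n} → DifferOnlyAt u v j →
  numBlocks (x ∷ u) ≡ numBlocks (x ∷ v) → c ≢ j →
  blockIdx (x ∷ u) (suc c) ≡ blockIdx (x ∷ v) (suc c)
blockIdx-∷-stable x (a ∷ u) (b ∷ v) {zero} {zero} _ _ c≢j = ⊥-elim (c≢j refl)
blockIdx-∷-stable x (a ∷ z ∷ u) (b ∷ v) {zero} {suc c} u≈v same _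
  with lookup-injective (z ∷ u) v (λ i → u≈v (suc i) (λ ()))
... | refl = replace-last-summand (boundary x a) (boundary a z) (boundary x b) (boundary b z)
               (numBlocks (z ∷ u)) (blockIdx (z ∷ u) c) same
blockIdx-∷-stable x (a ∷ u) (b ∷ v) {suc j} {c} u≈v same c≢j
  with DifferOnlyAt-head u≈v
blockIdx-∷-stable x (a ∷ u) (.a ∷ v) {suc j} {zero} u≈v same c≢j | refl = refl
blockIdx-∷-stable x (a ∷ u) (.a ∷ v) {suc j} {suc c} u≈v same c≢j | refl =
  cong (boundary x a +_)
    (blockIdx-∷-stable a u v (DifferOnlyAt-tail u≈v)
      (+-cancelˡ-≡ (boundary x a) _ _ same) (c≢j ∘ cong suc))

blockIdx-edge : ∀ {d k} {u v : Vec Bool d} {j c : Fin d} →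
  Edge k (just u) (just v) j → c ≢ j → blockIdx u c ≡ blockIdx v c
blockIdx-edge {u = x ∷ u} {y ∷ v} {zero} (word-word (x≡1 , _) (y≡1 , _) x≢y _) _ =
  ⊥-elim (x≢y (trans x≡1 (sym y≡1)))
blockIdx-edge {u = x ∷ u} {y ∷ v} {suc j} {zero} _ _ = refl
blockIdx-edge {u = x ∷ u} {y ∷ v} {suc j} {suc c} (word-word (_ , |u|) (_ , |v|) _ u≈v) c≢j
  with DifferOnlyAt-head u≈v
... | refl = blockIdx-∷-stable x u v (DifferOnlyAt-tail u≈v) (trans |u| (sym |v|)) (c≢j ∘ cong suc)

start∈vertices : ∀ {d k} {u v : Vertex d} (p : Walk k u v) → u ∈ vertices p
start∈vertices []      = here refl
start∈vertices (_ ∷ _) = here refl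

walk-changing-blockIdx : ∀ {d k} (c : Fin d) {w w′ : Vec Bool d} →
  blockIdx w c ≢ blockIdx w′ c → (p : Walk k (just w) (just w′)) →
  c ∈ labels p ⊎ nothing ∈ vertices p
walk-changing-blockIdx c w≢w′ [] = ⊥-elim (w≢w′ refl)
walk-changing-blockIdx c w≢w′ (word-α _ _ ∷ p) = inj₂ (there (start∈vertices p))
walk-changing-blockIdx c w≢w′ (_∷_ {j = j} e@(word-word _ _ _ _) p) with c ≟ j
... | yes c≡j = inj₁ (here c≡j)
... | no c≢j  = Sum.map there there
                  (walk-changing-blockIdx c (w≢w′ ∘ trans (blockIdx-edge e c≢j)) p)

lemma4p11 : (k d : ℕ) → 1 ≤ k → k < d → (c : Fin d) →
    (w w′ : Vec Bool d) → InW k w → InW k w′ →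
    blockIdx w c ≢ blockIdx w′ c →
    (p : Walk k (just w) (just w′)) → IsPath p →
    c ∈ labels p ⊎ nothing ∈ vertices p
lemma4p11 k d _ _ c w w′ _ _ w≢w′ p _ = walk-changing-blockIdx c w≢w′ p
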